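{- Let $(G,+)$ be a group with $n$ elements, let $\cdot$ be a binary operation on $G$, and let $S\subseteq G$ be a basis of $(G,+)$. Then the following are equivalent: (1) $a\cdot(b+c)=a\cdot b+a\cdot c$ for all $a,b,c\in G$; (2) $x\cdot(y+z)=x\cdot y+x\cdot z$ for all $x,z\in G$ and $y\in S$.
   Context: A basis of a group $(G,+)$ is a subset $S\subseteq G$ such that every $a\in G$ can be written as $a=\alpha+\beta$ with $\alpha,\beta\in S$. -}

module Defs where

open import Level using (Level; _⊔_)
open import Data.Nat using (ℕ)
open import Data.Fin using (Fin)
open import Data.Product using (Σ; ∃; ∃-syntax; _×_)
open import Function.Bundles using (Bijection)
open import Relation.Binary.PropositionalEquality using (setoid)
open import Algebra.Bundles using (Group)
open import Algebra.Definitions using (Congruent₂)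

-- The group G (written additively in the paper; its operation is _∙_ here)
-- has exactly n elements: a bijection between Fin n and its carrier setoid.
HasCard : ∀ {c ℓ} → Group c ℓ → ℕ → Set (c ⊔ ℓ)
HasCard G n = Bijection (setoid (Fin n)) (Group.setoid G)

IsBasis : ∀ {c ℓ p} (G : Group c ℓ) → (Group.Carrier G → Set p) → Set (c ⊔ ℓ ⊔ p)
IsBasis G S = ∀ a → ∃[ α ] ∃[ β ] (S α × S β × (a ≈ α ∙ β))
  where open Group G

BinOpOn : ∀ {c ℓ} (G : Group c ℓ) → (Group.Carrier G → Group.Carrier G → Group.Carrier G) → Set (c ⊔ ℓ)
BinOpOn G _·_ = Congruent₂ (Group._≈_ G) _·_

LeftDistribAll : ∀ {c ℓ} (G : Group c ℓ) → (Group.Carrier G → Group.Carrier G → Group.Carrier G) → Set (c ⊔ ℓ)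
LeftDistribAll G _·_ = ∀ a b c → (a · (b ∙ c)) ≈ ((a · b) ∙ (a · c))
  where open Group G

LeftDistribOn : ∀ {c ℓ p} (G : Group c ℓ) → (Group.Carrier G → Group.Carrier G → Group.Carrier G)
  → (Group.Carrier G → Set p) → Set (c ⊔ ℓ ⊔ p)
LeftDistribOn G _·_ S = ∀ x y z → S y → (x · (y ∙ z)) ≈ ((x · y) ∙ (x · z))
  where open Group G

module Submission where

open import Defs
open import Level using (_⊔_)
open import Data.Nat using (ℕ)
open import Function.Bundles using (_⇔_; mk⇔)
open import Algebra.Bundles using (Group; Semigroup)
open import Algebra.Definitions using (Congruent₂)
open import Data.Product using (_,_)
import Relation.Binary.Reasoning.Setoid as ≈-Reasoning

module _ {c ℓ} (G : Semigroup c ℓ) (_·_ : Semigroup.Carrier G → Semigroup.Carrier G → Semigroup.Carrier G)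
         (·-cong : Congruent₂ (Semigroup._≈_ G) _·_) where
  open Semigroup G
  open ≈-Reasoning setoid

  DistribˡAt : Carrier → Carrier → Set (c ⊔ ℓ)
  DistribˡAt a y = ∀ z → a · (y ∙ z) ≈ (a · y) ∙ (a · z)

  distribˡAt-∙ : ∀ {a α β} → DistribˡAt a α → DistribˡAt a β → DistribˡAt a (α ∙ β)
  distribˡAt-∙ {a} {α} {β} distrib-α distrib-β z = begin
    a · ((α ∙ β) ∙ z)             ≈⟨ ·-cong refl (assoc α β z) ⟩
    a · (α ∙ (β ∙ z))             ≈⟨ distrib-α (β ∙ z) ⟩
    (a · α) ∙ (a · (β ∙ z))       ≈⟨ ∙-congˡ (distrib-β z) ⟩
    (a · α) ∙ ((a · β) ∙ (a · z)) ≈⟨ assoc (a · α) (a · β) (a · z) ⟨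
    ((a · α) ∙ (a · β)) ∙ (a · z) ≈⟨ ∙-congʳ (distrib-α β) ⟨
    (a · (α ∙ β)) ∙ (a · z)       ∎

  distribˡAt-resp : ∀ {a x y} → x ≈ y → DistribˡAt a y → DistribˡAt a x
  distribˡAt-resp {a} {x} {y} x≈y distrib-y z = begin
    a · (x ∙ z)       ≈⟨ ·-cong refl (∙-congʳ x≈y) ⟩
    a · (y ∙ z)       ≈⟨ distrib-y z ⟩
    (a · y) ∙ (a · z) ≈⟨ ∙-congʳ (·-cong refl x≈y) ⟨
    (a · x) ∙ (a · z) ∎

lemma9p2 : ∀ {c ℓ p} (G : Group c ℓ) (n : ℕ) → HasCard G n
    → (_·_ : Group.Carrier G → Group.Carrier G → Group.Carrier G) → BinOpOn G _·_
    → (S : Group.Carrier G → Set p) → IsBasis G S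
    → LeftDistribAll G _·_ ⇔ LeftDistribOn G _·_ S
lemma9p2 G _ _ _·_ ·-cong S basis = mk⇔ (λ distrib x y z _ → distrib x y z) fromBasis
  where
  open Group G using (semigroup)
  fromBasis : LeftDistribOn G _·_ S → LeftDistribAll G _·_
  fromBasis distrib a b with basis b
  ... | α , β , α∈S , β∈S , b≈αβ =
    distribˡAt-resp semigroup _·_ ·-cong b≈αβ
      (distribˡAt-∙ semigroup _·_ ·-cong (λ z → distrib a α z α∈S) (λ z → distrib a β z β∈S))
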